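{- Let $a,b$ be relatively prime positive integers, $n\ge1$, let $P$ be an $(a,b)$-Dyck path of size $n$ with step sequence $\mathbf{u}=(u_1,\dots,u_{an})$, let $w=\mu_b(\mathbf{u})$, and for $i\in[1,b]$ let $\nu^i$ be the permutation of $\{1,\dots,an\}$ given by $\nu^i_j=w_{(j-1)b+i}$ ($1\le j\le an$). Let $\xi^i=\mu_1^{ -1}(\nu^i)$. Then each sequence $\xi^i$, $1\le i\le b$, is weakly increasing.
   Context: An $(a,b)$-Dyck path of size $n$ is a lattice path from $(0,0)$ to $(bn,an)$ with unit steps $N=(0,1)$, $E=(1,0)$ never going below $y=ax/b$; its step sequence is $(u_1,\dots,u_{an})$ with $u_k$ the $x$-coordinate of the $k$-th north step. For a positive integer $c$, the map $\mu_c$ sends a sequence $(u_1,\dots,u_m)$ of nonnegative integers with $u_k\le c(k-1)$ to the word obtained by starting with $1^c$ and, for $k=2,\dots,m$, inserting the block $k^c$ into the current word immediately after its first $u_k$ letters (the result is a $c$-Stirling permutation). For $c=1$, $\mu_1$ is a bijection onto permutations of $\{1,\dots,m\}$, and $\mu_1^{ -1}(w)=(\xi_1,\dots,\xi_m)$ where $\xi_k$ is the position of $k$ in the subword of $w$ formed by the letters $1,\dots,k$, minus one. -}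

module Defs where

open import Data.Nat using (ℕ; zero; suc; _+_; _*_; _∸_; _≤_; _≤?_; _≟_)
open import Data.Nat.Properties using (≤-totalOrder)
open import Data.List using (List; []; _∷_; length; take; drop; _++_; replicate; map; filter; applyUpTo)
open import Relation.Binary.PropositionalEquality using (_≡_)
open import Relation.Nullary using (does)
open import Data.Bool using (if_then_else_)

-- Lattice steps: N = (0,1), E = (1,0)
data Step : Set where
  N E : Step

#N #E : List Step → ℕ
#N [] = 0
#N (N ∷ s) = suc (#N s)
#N (E ∷ s) = #N s
#E [] = 0
#E (N ∷ s) = #E s
#E (E ∷ s) = suc (#E s)

-- An (a,b)-Dyck path of size n: a lattice path from (0,0) to (bn,an) made of
-- N and E steps never going below y = a x / b, i.e. every visited lattice point
-- (x,y) (= endpoint of some prefix of the step list) satisfies a*x ≤ b*y.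
record IsDyckPath (a b n : ℕ) (P : List Step) : Set where
  field
    numNorth : #N P ≡ a * n
    numEast  : #E P ≡ b * n
    above    : ∀ k → k ≤ length P → a * #E (take k P) ≤ b * #N (take k P)

-- Step sequence: u_k = x-coordinate of the k-th north step.
stepSeqFrom : ℕ → List Step → List ℕ
stepSeqFrom x [] = []
stepSeqFrom x (N ∷ s) = x ∷ stepSeqFrom x s
stepSeqFrom x (E ∷ s) = stepSeqFrom (suc x) s

stepSeq : List Step → List ℕ
stepSeq = stepSeqFrom 0

μGo : ℕ → ℕ → List ℕ → List ℕ → List ℕ
μGo c k w [] = w
μGo c k w (u ∷ us) = μGo c (suc k) (take u w ++ replicate c k ++ drop u w) us

μ : ℕ → List ℕ → List ℕ
μ c [] = []
μ c (u₁ ∷ us) = μGo c 2 (replicate c 1) us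

-- 1-indexed letter w_p of a word (default 0 out of range; never used out of range)
letterAt : List ℕ → ℕ → ℕ
letterAt [] p = 0
letterAt (x ∷ w) zero = 0
letterAt (x ∷ w) (suc zero) = x
letterAt (x ∷ w) (suc (suc p)) = letterAt w (suc p)

-- ν^i_j = w_{(j-1)b+i}, for 1 ≤ j ≤ m
ν : ℕ → ℕ → ℕ → List ℕ → List ℕ
ν b i m w = applyUpTo (λ j → letterAt w (j * b + i)) m

-- 0-based index of the first occurrence of k in a word (length if absent)
indexOf : ℕ → List ℕ → ℕ
indexOf k [] = 0
indexOf k (x ∷ w) = if does (x ≟ k) then 0 else suc (indexOf k w)

-- μ_1^{-1}(w) = (ξ_1,…,ξ_m), ξ_k = position of k in the subword of letters 1..k, minus one
μ₁⁻¹ : ℕ → List ℕ → List ℕ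
μ₁⁻¹ m w = applyUpTo (λ j → indexOf (suc j) (filter (λ x → x ≤? suc j) w)) m

{-# OPTIONS --safe #-}
-- Reading every b-th letter of μ_b(u) commutes with the insertions that build it: inserting the
-- block k^b after u letters inserts a single k into the residue class of c after #strided c u of
-- its letters. Hence ν^(c+1) = μ_1(#strided c ∘ u), and μ_1⁻¹ returns #strided c (u_j) capped at
-- j − 1. Both operations are monotone and the step sequence of a lattice path is weakly
-- increasing, so each ξ^i is weakly increasing.
module Submission where

open import Defs
open import Data.Nat using (ℕ; _≡ᵇ_; zero; suc; _+_; _*_; _∸_; _≤_; _<_; _≤?_; _⊓_; z≤n; s≤s)
open import Data.Nat.Properties
open import Data.Nat.Coprimality using (Coprime)
open import Data.List using (List; []; _∷_; length; take; drop; _++_; replicate; map; filter; applyUpTo)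
open import Data.List.Properties
  using (length-++; length-take; length-drop; length-replicate; length-map; take++drop≡id; drop-drop; ++-identityʳ; take-[]; drop-[]; filter-++; filter-all; filter-none)
open import Data.List.Relation.Unary.All as All using (All; []; _∷_)
open import Data.List.Relation.Unary.All.Properties using (take⁺; drop⁺; ++⁺)
open import Data.List.Relation.Unary.AllPairs using (AllPairs; []; _∷_)
open import Data.List.Relation.Unary.Linked using ([-]; _∷_)
open import Data.List.Relation.Unary.Sorted.TotalOrder ≤-totalOrder using (Sorted)
open import Data.List.Relation.Unary.Sorted.TotalOrder.Properties using (map⁺; applyUpTo⁺₁; AllPairs⇒Sorted)
open import Data.Bool using (true; false)
open import Data.Unit using (tt)
open import Relation.Binary.PropositionalEquality
open import Relation.Nullary using (contradiction)
open import Relation.Unary using (Pred; Decidable; ∁)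
open import Level using (Level)

private
  variable
    ℓ : Level
    A : Set

applyUpTo-cong : ∀ {f g : ℕ → A} m → (∀ j → j < m → f j ≡ g j) → applyUpTo f m ≡ applyUpTo g m
applyUpTo-cong zero f≗g = refl
applyUpTo-cong (suc m) f≗g =
  cong₂ _∷_ (f≗g 0 (s≤s z≤n)) (applyUpTo-cong m (λ j j<m → f≗g (suc j) (s≤s j<m)))

splice : ℕ → List A → List A → List A
splice t xs w = take t w ++ xs ++ drop t w

length-splice : ∀ t (xs w : List A) → length (splice t xs w) ≡ length xs + length w
length-splice zero    xs w       = length-++ xs
length-splice (suc t) xs []      = length-++ xs
length-splice (suc t) xs (y ∷ w) = trans (cong suc (length-splice t xs w)) (sym (+-suc _ _))

All-splice : ∀ {P : Pred A ℓ} t {xs w} → All P xs → All P w → All P (splice t xs w)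
All-splice t pxs pw = ++⁺ (take⁺ t pw) (++⁺ pxs (drop⁺ t pw))

filter-splice : ∀ {P : Pred A ℓ} (P? : Decidable P) t {xs} w →
  All (∁ P) xs → filter P? (splice t xs w) ≡ filter P? w
filter-splice P? t {xs} w ¬pxs = begin
  filter P? (take t w ++ xs ++ drop t w)                     ≡⟨ filter-++ P? (take t w) _ ⟩
  filter P? (take t w) ++ filter P? (xs ++ drop t w)         ≡⟨ cong (filter P? (take t w) ++_) (filter-++ P? xs _) ⟩
  filter P? (take t w) ++ filter P? xs ++ filter P? (drop t w)
    ≡⟨ cong (λ ys → filter P? (take t w) ++ ys ++ filter P? (drop t w)) (filter-none P? ¬pxs) ⟩
  filter P? (take t w) ++ filter P? (drop t w)               ≡⟨ filter-++ P? (take t w) _ ⟨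
  filter P? (take t w ++ drop t w)                           ≡⟨ cong (filter P?) (take++drop≡id t w) ⟩
  filter P? w                                                ∎
  where open ≡-Reasoning

-- indexOf tests does (x ≟ k), which computes to x ≡ᵇ k; that is the term to abstract over.
indexOf-++-∷ : ∀ k xs ys → All (_≢ k) xs → indexOf k (xs ++ k ∷ ys) ≡ length xs
indexOf-++-∷ k [] ys [] with k ≡ᵇ k | ≡⇒≡ᵇ k k refl
... | true  | _  = refl
... | false | ()
indexOf-++-∷ k (x ∷ xs) ys (x≢k ∷ xs≢k) with x ≡ᵇ k | ≡ᵇ⇒≡ x k
... | true  | x≡k = contradiction (x≡k tt) x≢k
... | false | _   = cong suc (indexOf-++-∷ k xs ys xs≢k)

indexOf-splice : ∀ t k w → All (_≢ k) w → indexOf k (splice t (k ∷ []) w) ≡ t ⊓ length w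
indexOf-splice t k w w≢k = trans (indexOf-++-∷ k (take t w) (drop t w) (take⁺ t w≢k)) (length-take t w)

filter-μGo₁ : ∀ K k w ts → K < k → filter (_≤? K) (μGo 1 k w ts) ≡ filter (_≤? K) w
filter-μGo₁ K k w []       K<k = refl
filter-μGo₁ K k w (t ∷ ts) K<k =
  trans (filter-μGo₁ K (suc k) _ ts (m<n⇒m<1+n K<k)) (filter-splice (_≤? K) t w (<⇒≱ K<k ∷ []))

All-≤-splice : ∀ t L w → All (_≤ L) w → All (_≤ suc L) (splice t (suc L ∷ []) w)
All-≤-splice t L w w≤L = All-splice t (≤-refl ∷ []) (All.map m≤n⇒m≤1+n w≤L)

indexOf-μGo₁ : ∀ L w ts p → length w ≡ L → All (_≤ L) w → p < length ts →
  indexOf (suc (L + p)) (filter (_≤? suc (L + p)) (μGo 1 (suc L) w ts)) ≡ letterAt ts (suc p) ⊓ (L + p)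
indexOf-μGo₁ L w (t ∷ ts) zero |w|≡L w≤L _ rewrite +-identityʳ L = begin
  indexOf (suc L) (filter (_≤? suc L) (μGo 1 (suc (suc L)) w′ ts)) ≡⟨ cong (indexOf (suc L)) (filter-μGo₁ (suc L) _ w′ ts ≤-refl) ⟩
  indexOf (suc L) (filter (_≤? suc L) w′)                           ≡⟨ cong (indexOf (suc L)) (filter-all (_≤? suc L) (All-≤-splice t L w w≤L)) ⟩
  indexOf (suc L) w′                                                ≡⟨ indexOf-splice t (suc L) w (All.map (λ x≤L → <⇒≢ (s≤s x≤L)) w≤L) ⟩
  t ⊓ length w                                                      ≡⟨ cong (t ⊓_) |w|≡L ⟩
  t ⊓ L                                                             ∎
  where
  open ≡-Reasoning
  w′ = splice t (suc L ∷ []) w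
indexOf-μGo₁ L w (t ∷ ts) (suc p) |w|≡L w≤L (s≤s p<|ts|) rewrite +-suc L p =
  indexOf-μGo₁ (suc L) (splice t (suc L ∷ []) w) ts p
    (trans (length-splice t (suc L ∷ []) w) (cong suc |w|≡L)) (All-≤-splice t L w w≤L) p<|ts|

indexOf-μ₁ : ∀ ts j → j < length ts → indexOf (suc j) (filter (_≤? suc j) (μ 1 ts)) ≡ letterAt ts (suc j) ⊓ j
indexOf-μ₁ (t ∷ ts) zero    _          = trans (cong (indexOf 1) (filter-μGo₁ 1 2 (1 ∷ []) ts ≤-refl)) (sym (⊓-zeroʳ t))
indexOf-μ₁ (t ∷ ts) (suc j) (s≤s j<|ts|) = indexOf-μGo₁ 1 (1 ∷ []) ts j refl (≤-refl ∷ []) j<|ts|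

-- μ 1 ignores t₁ and reads an insertion position past the end of the word as its end,
-- so μ₁⁻¹ recovers t_j only up to the cap j − 1.
capped : ℕ → List ℕ → List ℕ
capped m ts = applyUpTo (λ j → letterAt ts (suc j) ⊓ j) m

μ₁⁻¹-μ₁ : ∀ m ts → m ≤ length ts → μ₁⁻¹ m (μ 1 ts) ≡ capped m ts
μ₁⁻¹-μ₁ m ts m≤|ts| = applyUpTo-cong m (λ j j<m → indexOf-μ₁ ts j (≤-trans j<m m≤|ts|))

Sorted⇒letterAt-mono : ∀ {xs} → Sorted xs → ∀ j → suc j < length xs → letterAt xs (suc j) ≤ letterAt xs (suc (suc j))
Sorted⇒letterAt-mono (x≤y ∷ _)  zero    _          = x≤y
Sorted⇒letterAt-mono (_ ∷ xs↗) (suc j) (s≤s j<|xs|) = Sorted⇒letterAt-mono xs↗ j j<|xs|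
Sorted⇒letterAt-mono [-]        _       (s≤s ())

capped-sorted : ∀ m {ts} → m ≤ length ts → Sorted ts → Sorted (capped m ts)
capped-sorted m m≤|ts| ts↗ = applyUpTo⁺₁ ≤-totalOrder _ m
  (λ {j} j+1<m → ⊓-mono-≤ (Sorted⇒letterAt-mono ts↗ j (≤-trans j+1<m m≤|ts|)) (n≤1+n j))

letterAt-drop : ∀ n w q → letterAt w (n + suc q) ≡ letterAt (drop n w) (suc q)
letterAt-drop zero    w       q = refl
letterAt-drop (suc n) []      q = refl
letterAt-drop (suc n) (x ∷ w) q = begin
  letterAt (x ∷ w) (suc (n + suc q)) ≡⟨ cong (λ p → letterAt (x ∷ w) (suc p)) (+-suc n q) ⟩
  letterAt w (suc (n + q))           ≡⟨ cong (letterAt w) (+-suc n q) ⟨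
  letterAt w (n + suc q)             ≡⟨ letterAt-drop n w q ⟩
  letterAt (drop n w) (suc q)        ∎
  where open ≡-Reasoning

drop≡letterAt∷drop : ∀ c w → c < length w → drop c w ≡ letterAt w (suc c) ∷ drop (suc c) w
drop≡letterAt∷drop zero    (x ∷ w) _            = refl
drop≡letterAt∷drop (suc c) (x ∷ w) (s≤s c<|w|) = drop≡letterAt∷drop c w c<|w|

length-μGo : ∀ c k w us → length (μGo c k w us) ≡ length us * c + length w
length-μGo c k w []       = refl
length-μGo c k w (u ∷ us) = begin
  length (μGo c (suc k) (splice u (replicate c k) w) us)  ≡⟨ length-μGo c (suc k) _ us ⟩
  length us * c + length (splice u (replicate c k) w)      ≡⟨ cong (length us * c +_) (length-splice u (replicate c k) w) ⟩
  length us * c + (length (replicate c k) + length w)      ≡⟨ cong (λ r → length us * c + (r + length w)) (length-replicate c) ⟩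
  length us * c + (c + length w)                           ≡⟨ +-assoc (length us * c) c (length w) ⟨
  length us * c + c + length w                             ≡⟨ cong (_+ length w) (+-comm (length us * c) c) ⟩
  c + length us * c + length w                             ∎
  where open ≡-Reasoning

module Strided (b′ : ℕ) where

  b : ℕ
  b = suc b′

  -- strided c w = w[c], w[c + b], w[c + 2b], … (0-based): ν^(c+1) w when b divides the length of w.
  strided : ℕ → List ℕ → List ℕ
  strided c       []      = []
  strided zero    (x ∷ w) = x ∷ strided b′ w
  strided (suc c) (x ∷ w) = strided c w

  -- #strided c u counts the positions p < u with p ≥ c and p ≡ c (mod b): the length of
  -- strided c of a word of length u.
  #strided : ℕ → ℕ → ℕ
  #strided c       zero    = zero
  #strided zero    (suc u) = suc (#strided b′ u)
  #strided (suc c) (suc u) = #strided c u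

  #strided-zero : ∀ c → #strided c 0 ≡ 0
  #strided-zero zero    = refl
  #strided-zero (suc c) = refl

  #strided-mono : ∀ c {u v} → u ≤ v → #strided c u ≤ #strided c v
  #strided-mono c       {zero}  _         rewrite #strided-zero c = z≤n
  #strided-mono zero    {suc u} (s≤s u≤v) = s≤s (#strided-mono b′ u≤v)
  #strided-mono (suc c) {suc u} (s≤s u≤v) = #strided-mono c u≤v

  strided-drop : ∀ c w → strided c w ≡ strided 0 (drop c w)
  strided-drop zero    w       = refl
  strided-drop (suc c) []      = refl
  strided-drop (suc c) (x ∷ w) = strided-drop c w

  strided-replicate-++ : ∀ d c k w → strided (d + c) (replicate d k ++ w) ≡ strided c w
  strided-replicate-++ zero    c k w = refl
  strided-replicate-++ (suc d) c k w = strided-replicate-++ d c k w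

  strided-replicate : ∀ c e k w → strided c (replicate (c + suc e) k ++ w) ≡ k ∷ strided b′ (replicate e k ++ w)
  strided-replicate zero    e k w = refl
  strided-replicate (suc c) e k w = strided-replicate c e k w

  strided-block : ∀ c k w → c ≤ b′ → strided c (replicate b k ++ w) ≡ k ∷ strided c w
  strided-block c k w c≤b′ = begin
    strided c (replicate b k ++ w)            ≡⟨ cong (λ n → strided c (replicate n k ++ w)) b≡c+suc[b′∸c] ⟩
    strided c (replicate (c + suc e) k ++ w)  ≡⟨ strided-replicate c e k w ⟩
    k ∷ strided b′ (replicate e k ++ w)       ≡⟨ cong (λ d → k ∷ strided d (replicate e k ++ w)) (m∸n+n≡m c≤b′) ⟨
    k ∷ strided (e + c) (replicate e k ++ w)  ≡⟨ cong (k ∷_) (strided-replicate-++ e c k w) ⟩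
    k ∷ strided c w                           ∎
    where
    open ≡-Reasoning
    e = b′ ∸ c
    b≡c+suc[b′∸c] : b ≡ c + suc e
    b≡c+suc[b′∸c] = trans (cong suc (sym (m+[n∸m]≡n c≤b′))) (sym (+-suc c e))

  strided-splice : ∀ u c k w → c ≤ b′ →
    strided c (splice u (replicate b k) w) ≡ splice (#strided c u) (k ∷ []) (strided c w)
  strided-splice zero    c       k w       c≤b′ rewrite #strided-zero c = strided-block c k w c≤b′
  strided-splice (suc u) c       k []      c≤b′
    rewrite take-[] {A = ℕ} (#strided c (suc u)) | drop-[] {A = ℕ} (#strided c (suc u)) = strided-block c k [] c≤b′
  strided-splice (suc u) zero    k (x ∷ w) _           = cong (x ∷_) (strided-splice u b′ k w ≤-refl)
  strided-splice (suc u) (suc c) k (x ∷ w) (s≤s c≤b′) = strided-splice u c k w (m≤n⇒m≤1+n c≤b′)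

  strided-μGo : ∀ us c k w → c ≤ b′ → strided c (μGo b k w us) ≡ μGo 1 k (strided c w) (map (#strided c) us)
  strided-μGo []       c k w c≤b′ = refl
  strided-μGo (u ∷ us) c k w c≤b′ =
    trans (strided-μGo us c (suc k) _ c≤b′)
          (cong (λ v → μGo 1 (suc k) v (map (#strided c) us)) (strided-splice u c k w c≤b′))

  strided-∷ : ∀ c w → c ≤ b′ → b ≤ length w → strided c w ≡ letterAt w (suc c) ∷ strided c (drop b w)
  strided-∷ c w c≤b′ b≤|w| = begin
    strided c w                                 ≡⟨ strided-drop c w ⟩
    strided 0 (drop c w)                        ≡⟨ cong (strided 0) (drop≡letterAt∷drop c w (≤-trans (s≤s c≤b′) b≤|w|)) ⟩
    x ∷ strided b′ (drop (suc c) w)             ≡⟨ cong (x ∷_) (strided-drop b′ (drop (suc c) w)) ⟩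
    x ∷ strided 0 (drop b′ (drop (suc c) w))    ≡⟨ cong (λ v → x ∷ strided 0 v) (drop-drop (suc c) b′ w) ⟩
    x ∷ strided 0 (drop (suc (c + b′)) w)       ≡⟨ cong (λ n → x ∷ strided 0 (drop (suc n) w)) (+-comm c b′) ⟩
    x ∷ strided 0 (drop (b + c) w)              ≡⟨ cong (λ v → x ∷ strided 0 v) (drop-drop b c w) ⟨
    x ∷ strided 0 (drop c (drop b w))           ≡⟨ cong (x ∷_) (strided-drop c (drop b w)) ⟨
    x ∷ strided c (drop b w)                    ∎
    where
    open ≡-Reasoning
    x = letterAt w (suc c)

  ν≡strided : ∀ m w c → c ≤ b′ → length w ≡ m * b → ν b (suc c) m w ≡ strided c w
  ν≡strided zero    []      c _    _     = refl
  ν≡strided (suc m) w       c c≤b′ |w|≡ = begin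
    ν b (suc c) (suc m) w                          ≡⟨ cong (x ∷_) (applyUpTo-cong m (λ j _ → letterAt-shift j)) ⟩
    x ∷ ν b (suc c) m (drop b w)                   ≡⟨ cong (x ∷_) (ν≡strided m (drop b w) c c≤b′ |drop|≡) ⟩
    x ∷ strided c (drop b w)                       ≡⟨ strided-∷ c w c≤b′ (subst (b ≤_) (sym |w|≡) (m≤m+n b (m * b))) ⟨
    strided c w                                    ∎
    where
    open ≡-Reasoning
    x = letterAt w (suc c)
    |drop|≡ : length (drop b w) ≡ m * b
    |drop|≡ = trans (length-drop b w) (trans (cong (_∸ b) |w|≡) (m+n∸m≡n b (m * b)))
    letterAt-shift : ∀ j → letterAt w (suc j * b + suc c) ≡ letterAt (drop b w) (j * b + suc c)
    letterAt-shift j = begin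
      letterAt w (b + j * b + suc c)        ≡⟨ cong (letterAt w) (trans (+-assoc b (j * b) (suc c)) (cong (b +_) (+-suc (j * b) c))) ⟩
      letterAt w (b + suc (j * b + c))      ≡⟨ letterAt-drop b w (j * b + c) ⟩
      letterAt (drop b w) (suc (j * b + c)) ≡⟨ cong (letterAt (drop b w)) (+-suc (j * b) c) ⟨
      letterAt (drop b w) (j * b + suc c)   ∎

  ν-μ≡μ₁ : ∀ c us → c ≤ b′ → ν b (suc c) (length us) (μ b us) ≡ μ 1 (map (#strided c) us)
  ν-μ≡μ₁ c []       _    = refl
  ν-μ≡μ₁ c (u ∷ us) c≤b′ = begin
    ν b (suc c) (length (u ∷ us)) W                          ≡⟨ ν≡strided (length (u ∷ us)) W c c≤b′ |W|≡ ⟩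
    strided c W                                              ≡⟨ strided-μGo us c 2 (replicate b 1) c≤b′ ⟩
    μGo 1 2 (strided c (replicate b 1)) (map (#strided c) us) ≡⟨ cong (λ v → μGo 1 2 v (map (#strided c) us)) first-block ⟩
    μGo 1 2 (1 ∷ []) (map (#strided c) us)                    ∎
    where
    open ≡-Reasoning
    W = μGo b 2 (replicate b 1) us
    |W|≡ : length W ≡ length (u ∷ us) * b
    |W|≡ = trans (length-μGo b 2 (replicate b 1) us)
             (trans (cong (length us * b +_) (length-replicate b)) (+-comm (length us * b) b))
    first-block : strided c (replicate b 1) ≡ 1 ∷ []
    first-block = trans (cong (strided c) (sym (++-identityʳ (replicate b 1)))) (strided-block c 1 [] c≤b′)

μ₁⁻¹-ν-μ-sorted : ∀ b′ c → c ≤ b′ → ∀ us → Sorted us →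
  Sorted (μ₁⁻¹ (length us) (ν (suc b′) (suc c) (length us) (μ (suc b′) us)))
μ₁⁻¹-ν-μ-sorted b′ c c≤b′ us us↗ =
  subst Sorted (sym ξ≡capped) (capped-sorted (length us) |us|≤|ts| (map⁺ ≤-totalOrder ≤-totalOrder (#strided-mono c) us↗))
  where
  open Strided b′
  ts = map (#strided c) us
  |us|≤|ts| : length us ≤ length ts
  |us|≤|ts| = ≤-reflexive (sym (length-map (#strided c) us))
  ξ≡capped : μ₁⁻¹ (length us) (ν b (suc c) (length us) (μ b us)) ≡ capped (length us) ts
  ξ≡capped = trans (cong (μ₁⁻¹ (length us)) (ν-μ≡μ₁ c us c≤b′)) (μ₁⁻¹-μ₁ (length us) ts |us|≤|ts|)

length-stepSeqFrom : ∀ x s → length (stepSeqFrom x s) ≡ #N s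
length-stepSeqFrom x []      = refl
length-stepSeqFrom x (N ∷ s) = cong suc (length-stepSeqFrom x s)
length-stepSeqFrom x (E ∷ s) = length-stepSeqFrom (suc x) s

stepSeqFrom-≥ : ∀ x s → All (x ≤_) (stepSeqFrom x s)
stepSeqFrom-≥ x []      = []
stepSeqFrom-≥ x (N ∷ s) = ≤-refl ∷ stepSeqFrom-≥ x s
stepSeqFrom-≥ x (E ∷ s) = All.map (≤-trans (n≤1+n x)) (stepSeqFrom-≥ (suc x) s)

stepSeqFrom-increasing : ∀ x s → AllPairs _≤_ (stepSeqFrom x s)
stepSeqFrom-increasing x []      = []
stepSeqFrom-increasing x (N ∷ s) = stepSeqFrom-≥ x s ∷ stepSeqFrom-increasing x s
stepSeqFrom-increasing x (E ∷ s) = stepSeqFrom-increasing (suc x) s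

mainTheorem5 : (a b n : ℕ) → 1 ≤ a → 1 ≤ b → Coprime a b → 1 ≤ n →
    (P : List Step) → IsDyckPath a b n P →
    (i : ℕ) → 1 ≤ i → i ≤ b →
    Sorted (μ₁⁻¹ (a * n) (ν b i (a * n) (μ b (stepSeq P))))
mainTheorem5 a (suc b′) n _ _ _ _ P P-Dyck (suc c) _ (s≤s c≤b′) =
  subst (λ m → Sorted (μ₁⁻¹ m (ν (suc b′) (suc c) m (μ (suc b′) (stepSeq P))))) |u|≡an
    (μ₁⁻¹-ν-μ-sorted b′ c c≤b′ (stepSeq P) (AllPairs⇒Sorted ≤-totalOrder (stepSeqFrom-increasing 0 P)))
  where
  |u|≡an : length (stepSeq P) ≡ a * n
  |u|≡an = trans (length-stepSeqFrom 0 P) (IsDyckPath.numNorth P-Dyck)
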